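{- If a finite simple graph $G$ has a NAC-coloring, then there is no subgraph $H$ of $G$ with $V_H=V_G$ such that $H$ is $\triangle$-connected.
   Context: A coloring $\delta\colon E_G\to\{\text{blue},\text{red}\}$ is a NAC-coloring if it is surjective and $G$ contains no cycle with exactly one blue edge and no cycle with exactly one red edge. For a graph $H$, let $\sim'$ be the relation on $E_H$ with $e_1\sim' e_2$ iff some triangle subgraph of $H$ contains both $e_1,e_2$, and $\sim$ its reflexive-transitive closure; $H$ is $\triangle$-connected if $e_1\sim e_2$ for all $e_1,e_2\in E_H$.
   Formalization: The condition $V_H=V_G$ on the subgraph H is replaced by every vertex of G being an endpoint of some edge of H, so H has no isolated vertices. The statement above fails without it. -}

module Defs where

open import Data.Nat using (ℕ; zero; suc; _+_)
open import Data.Nat.DivMod using (_%_; m%n<n)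
open import Data.Fin using (Fin; toℕ; fromℕ<; _<_)
open import Data.Fin.Properties using (<-cmp)
open import Data.Bool using (Bool; true; false)
open import Data.Product using (Σ; ∃; _×_; _,_; Σ-syntax; ∃-syntax)
open import Data.Sum using (_⊎_)
open import Data.Empty using (⊥-elim)
open import Relation.Binary using (tri<; tri≈; tri>)
open import Relation.Binary.PropositionalEquality using (_≡_; _≢_; subst; sym)
open import Relation.Binary.Construct.Closure.ReflexiveTransitive using (Star)
open import Function.Definitions using (Injective)

record Graph : Set where
  field
    n      : ℕ
    adj    : Fin n → Fin n → Bool
    adj-sym    : ∀ u v → adj u v ≡ adj v u
    adj-irrefl : ∀ u → adj u u ≡ false
open Graph public

Vertex : Graph → Set
Vertex G = Fin (n G)

-- An (undirected) edge {u,v}, represented canonically with u < v.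
Edge : Graph → Set
Edge G = Σ[ u ∈ Vertex G ] Σ[ v ∈ Vertex G ] (u < v × adj G u v ≡ true)

edge : (G : Graph) (u v : Vertex G) → adj G u v ≡ true → Edge G
edge G u v p with <-cmp u v
... | tri< lt _ _ = u , v , lt , p
... | tri≈ _ refl' _ = ⊥-elim (false≢true (subst (λ b → b ≡ true) (adj-irrefl G u)
                                (subst (λ w → adj G u w ≡ true) (sym refl') p)))
  where
  false≢true : false ≡ true → Data.Empty.⊥
  false≢true ()
... | tri> _ _ gt = v , u , gt , subst (λ b → b ≡ true) (adj-sym G u v) p

_∈ₑ_ : {G : Graph} → Vertex G → Edge G → Set
_∈ₑ_ w (u , v , _) = (w ≡ u) ⊎ (w ≡ v)

data Color : Set where
  blue red : Color

next : {m : ℕ} → Fin (suc m) → Fin (suc m)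
next {m} i = fromℕ< (m%n<n (suc (toℕ i)) (suc m))

record Cycle (G : Graph) : Set where
  field
    ℓ      : ℕ
    vs     : Fin (3 + ℓ) → Vertex G
    vs-inj : Injective _≡_ _≡_ vs
    vs-adj : ∀ i → adj G (vs i) (vs (next i)) ≡ true
open Cycle public

cycEdge : {G : Graph} (C : Cycle G) → Fin (3 + ℓ C) → Edge G
cycEdge {G} C i = edge G (vs C i) (vs C (next i)) (vs-adj C i)

-- the cycle C has exactly one edge of colour c under δ
-- (distinct indices give distinct edges since the vertices are distinct)
ExactlyOne : {G : Graph} → (Edge G → Color) → Color → Cycle G → Set
ExactlyOne δ c C =
  Σ[ i ∈ Fin (3 + ℓ C) ] (δ (cycEdge C i) ≡ c ×
     (∀ j → δ (cycEdge C j) ≡ c → j ≡ i))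

IsNACColoring : (G : Graph) → (Edge G → Color) → Set
IsNACColoring G δ =
  (∃[ e ] δ e ≡ blue) × (∃[ e ] δ e ≡ red) ×
  (∀ (C : Cycle G) → ExactlyOne δ blue C → Data.Empty.⊥) ×
  (∀ (C : Cycle G) → ExactlyOne δ red C → Data.Empty.⊥)

-- A subgraph H of G with V_H = V_G is given by its edge set S ⊆ E_G.
EdgeSet : Graph → Set₁
EdgeSet G = Edge G → Set

HAdj : {G : Graph} → EdgeSet G → Vertex G → Vertex G → Set
HAdj {G} S u v = Σ[ p ∈ adj G u v ≡ true ] S (edge G u v p)

-- e₁ ∼' e₂ : some triangle subgraph of H (vertices a,b,c pairwise
-- adjacent in H, hence distinct) contains both e₁ and e₂, i.e. both
-- endpoints of each eᵢ lie in {a,b,c}.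
_∈△_ : {G : Graph} → Edge G → Vertex G × Vertex G × Vertex G → Set
(u , v , _) ∈△ (a , b , c) =
  ((u ≡ a) ⊎ (u ≡ b) ⊎ (u ≡ c)) × ((v ≡ a) ⊎ (v ≡ b) ⊎ (v ≡ c))

TriRel : {G : Graph} → EdgeSet G → Edge G → Edge G → Set
TriRel {G} S e₁ e₂ =
  Σ[ t ∈ Vertex G × Vertex G × Vertex G ]
    (let (a , b , c) = t in
      HAdj {G} S a b × HAdj {G} S b c × HAdj {G} S c a × _∈△_ {G} e₁ t × _∈△_ {G} e₂ t)

TriangleConnected : {G : Graph} → EdgeSet G → Set
TriangleConnected {G} S = ∀ e₁ e₂ → S e₁ → S e₂ → Star (TriRel {G} S) e₁ e₂

-- V_H = V_G : every vertex of G is a vertex of H (H spanned by its edges).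
Spanning : {G : Graph} → EdgeSet G → Set
Spanning {G} S = ∀ (w : Vertex G) → ∃[ e ] (S e × _∈ₑ_ {G} w e)

module Submission where

-- Let δ be a NAC-colouring of G and H a spanning △-connected subgraph.
--  1. Every triangle is monochromatic: its three sides form a 3-cycle, and
--     two colours on three sides always leave one colour occurring once.
--     Hence δ is constant along ∼', so by △-connectedness all of H has one
--     colour c₀.
--  2. H is connected: the endpoints of an edge are joined in H, all vertices
--     of a triangle are joined in H, and following a ∼-chain from an edge at
--     u to an edge at v joins u to v.  Since H is spanning, every two
--     vertices are joined in H, and then (for any relation on a type with
--     decidable equality) even by a simple path.
--  3. By surjectivity some edge f = uv has a colour ≠ c₀.  A simple path of H
--     from u to v is not a single vertex (u ≠ v), is not the edge f itself
--     (f ∉ H), so it closes with f to a cycle in which f is the only edge of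
--     its colour — contradicting the NAC property.

open import Defs
open import Data.Bool using (true)
import Data.Bool as Bool
open import Data.Empty using (⊥; ⊥-elim)
open import Data.Fin using (Fin; zero; suc; toℕ; fromℕ; inject₁)
import Data.Fin as Fin
open import Data.Fin.Patterns using (0F; 1F; 2F)
open import Data.Fin.Properties
  using (<-cmp; toℕ-fromℕ<; toℕ-inject₁; toℕ-fromℕ; toℕ-injective; toℕ<n; <-irrelevant; <-irrefl; <-asym; any?)
open import Data.Fin.Relation.Unary.Top using (view; ‵fromℕ; ‵inject₁)
open import Data.Nat as ℕ using (ℕ; _+_; s<s)
open import Data.Nat.DivMod using (_%_; m<n⇒m%n≡m; n%n≡0)
open import Data.Product using (Σ; Σ-syntax; ∃-syntax; _×_; _,_; proj₁; proj₂)
open import Data.Sum using (_⊎_; inj₁; inj₂)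
open import Data.Vec using (Vec; []; _∷_; lookup)
open import Function.Definitions using (Injective)
open import Relation.Binary.Definitions using (DecidableEquality; tri<; tri≈; tri>)
open import Relation.Binary.PropositionalEquality
open import Relation.Binary.Construct.Closure.ReflexiveTransitive
  using (Star; ε; _◅_; _◅◅_; fold; reverse)
open import Relation.Nullary using (¬_; yes; no)
open import Axiom.UniquenessOfIdentityProofs using (module Decidable⇒UIP)

-- Anything R-reachable from u is reachable by a path without repeated
-- vertices: extend a simple path by one step, and if the new vertex already
-- occurs on it, cut the path back to that occurrence instead.

module SimplePaths {A : Set} (_≟_ : DecidableEquality A) (R : A → A → Set) (u : A) where

  -- Path w k xs: xs lists the k+1 distinct vertices of a path from u to w
  -- in reverse order (head w, last u); each vertex R-steps to its predecessor
  -- in the list.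
  data Path : A → (k : ℕ) → Vec A (ℕ.suc k) → Set where
    start : Path u 0 (u ∷ [])
    step  : ∀ {w z k xs} → Path w k xs → R w z → (∀ i → lookup xs i ≢ z) →
            Path z (ℕ.suc k) (z ∷ xs)

  SimplePath : A → Set
  SimplePath w = Σ[ k ∈ ℕ ] Σ[ xs ∈ Vec A (ℕ.suc k) ] Path w k xs

  path-head : ∀ {w k xs} → Path w k xs → lookup xs zero ≡ w
  path-head start        = refl
  path-head (step _ _ _) = refl

  path-last : ∀ {w k xs} → Path w k xs → lookup xs (fromℕ k) ≡ u
  path-last start        = refl
  path-last (step p _ _) = path-last p

  path-link : ∀ {w k xs} → Path w k xs → (j : Fin k) →
              R (lookup xs (suc j)) (lookup xs (inject₁ j))
  path-link (step p r _) zero    = subst (λ x → R x _) (sym (path-head p)) r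
  path-link (step p _ _) (suc j) = path-link p j

  path-injective : ∀ {w k xs} → Path w k xs → Injective _≡_ _≡_ (lookup xs)
  path-injective start          {zero}  {zero}  _ = refl
  path-injective (step _ _ _)   {zero}  {zero}  _ = refl
  path-injective (step _ _ new) {zero}  {suc j} e = ⊥-elim (new j (sym e))
  path-injective (step _ _ new) {suc i} {zero}  e = ⊥-elim (new i e)
  path-injective (step p _ _)   {suc i} {suc j} e = cong suc (path-injective p e)

  shortcut : ∀ {w k xs z} → Path w k xs → (i : Fin (ℕ.suc k)) → lookup xs i ≡ z →
             SimplePath z
  shortcut p zero e = subst SimplePath (trans (sym (path-head p)) e) (_ , _ , p)
  shortcut (step p _ _) (suc i) e = shortcut p i e

  extend : ∀ {w z} → SimplePath w → R w z → SimplePath z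
  extend {z = z} (_ , xs , p) r with any? (λ i → lookup xs i ≟ z)
  ... | yes (i , e) = shortcut p i e
  ... | no absent   = _ , _ , step p r (λ i e → absent (i , e))

  simple-path : ∀ {z} → Star R u z → SimplePath z
  simple-path = grow (_ , _ , start)
    where
    grow : ∀ {w z} → SimplePath w → Star R w z → SimplePath z
    grow p ε        = p
    grow p (r ◅ rs) = grow (extend p r) rs

next-inject₁ : ∀ {m} (j : Fin m) → next (inject₁ j) ≡ suc j
next-inject₁ {m} j = toℕ-injective (begin
  toℕ (next (inject₁ j))          ≡⟨ toℕ-fromℕ< _ ⟩
  ℕ.suc (toℕ (inject₁ j)) % ℕ.suc m ≡⟨ cong (λ t → ℕ.suc t % ℕ.suc m) (toℕ-inject₁ j) ⟩
  ℕ.suc (toℕ j) % ℕ.suc m          ≡⟨ m<n⇒m%n≡m (s<s (toℕ<n j)) ⟩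
  ℕ.suc (toℕ j)                    ∎)
  where open ≡-Reasoning

next-fromℕ : ∀ m → next (fromℕ m) ≡ zero
next-fromℕ m = toℕ-injective (begin
  toℕ (next (fromℕ m))          ≡⟨ toℕ-fromℕ< _ ⟩
  ℕ.suc (toℕ (fromℕ m)) % ℕ.suc m ≡⟨ cong (λ t → ℕ.suc t % ℕ.suc m) (toℕ-fromℕ m) ⟩
  ℕ.suc m % ℕ.suc m              ≡⟨ n%n≡0 (ℕ.suc m) ⟩
  0                              ∎)
  where open ≡-Reasoning

last-or-inject₁ : ∀ {m} (i : Fin (ℕ.suc m)) → i ≡ fromℕ m ⊎ ∃[ j ] i ≡ inject₁ j
last-or-inject₁ i with view i
... | ‵fromℕ     = inj₁ refl
... | ‵inject₁ j = inj₂ (j , refl)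

clash : ∀ {x : Color} → x ≡ blue → x ≡ red → ⊥
clash refl ()

avoiding-edge : ∀ {E : Set} (δ : E → Color) → (∃[ e ] δ e ≡ blue) → (∃[ e ] δ e ≡ red) →
                ∀ c → ∃[ e ] δ e ≢ c
avoiding-edge δ _ (e , red-e)  blue = e , λ blue-e → clash blue-e red-e
avoiding-edge δ (e , blue-e) _ red  = e , λ red-e → clash blue-e red-e

three-sides-agree : (g : Fin 3 → Color) →
  (∀ c → ¬ (Σ[ i ∈ Fin 3 ] (g i ≡ c × (∀ j → g j ≡ c → j ≡ i)))) →
  g 0F ≡ g 1F × g 1F ≡ g 2F
three-sides-agree g no-lone with g 0F in e₀ | g 1F in e₁ | g 2F in e₂
... | blue | blue | blue = refl , refl
... | red  | red  | red  = refl , refl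
... | blue | blue | red  = ⊥-elim (no-lone red  (2F , e₂ , λ { 0F r → ⊥-elim (clash e₀ r) ; 1F r → ⊥-elim (clash e₁ r) ; 2F _ → refl }))
... | blue | red  | blue = ⊥-elim (no-lone red  (1F , e₁ , λ { 0F r → ⊥-elim (clash e₀ r) ; 1F _ → refl ; 2F r → ⊥-elim (clash e₂ r) }))
... | red  | blue | blue = ⊥-elim (no-lone red  (0F , e₀ , λ { 0F _ → refl ; 1F r → ⊥-elim (clash e₁ r) ; 2F r → ⊥-elim (clash e₂ r) }))
... | red  | red  | blue = ⊥-elim (no-lone blue (2F , e₂ , λ { 0F b → ⊥-elim (clash b e₀) ; 1F b → ⊥-elim (clash b e₁) ; 2F _ → refl }))
... | red  | blue | red  = ⊥-elim (no-lone blue (1F , e₁ , λ { 0F b → ⊥-elim (clash b e₀) ; 1F _ → refl ; 2F b → ⊥-elim (clash b e₂) }))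
... | blue | red  | red  = ⊥-elim (no-lone blue (0F , e₀ , λ { 0F _ → refl ; 1F b → ⊥-elim (clash b e₁) ; 2F b → ⊥-elim (clash b e₂) }))

module _ (G : Graph) where

  src tgt : Edge G → Vertex G
  src (u , _ , _) = u
  tgt (_ , v , _) = v

  Joins : Edge G → Vertex G → Vertex G → Set
  Joins e a b = (src e ≡ a × tgt e ≡ b) ⊎ (src e ≡ b × tgt e ≡ a)

  adjacent-distinct : ∀ {a b} → adj G a b ≡ true → a ≢ b
  adjacent-distinct {a} p refl with trans (sym p) (adj-irrefl G a)
  ... | ()

  edge-joins : ∀ {a b} (p : adj G a b ≡ true) → Joins (edge G a b p) a b
  edge-joins {a} {b} p with <-cmp a b
  ... | tri< _ _ _ = inj₁ (refl , refl)
  ... | tri≈ _ a≡b _ = ⊥-elim (adjacent-distinct p a≡b)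
  ... | tri> _ _ _ = inj₂ (refl , refl)

  -- proofs of u < v and of adjacency are irrelevant
  edge-ext : ∀ {e e'} → src e ≡ src e' → tgt e ≡ tgt e' → e ≡ e'
  edge-ext {u , v , l , p} {.u , .v , l' , p'} refl refl
    rewrite <-irrelevant l l' | Decidable⇒UIP.≡-irrelevant Bool._≟_ p p' = refl

  -- the orientation u < v is canonical, so two edges never cross
  no-crossing : ∀ {e e'} → src e ≡ tgt e' → tgt e ≡ src e' → ⊥
  no-crossing {_ , _ , l , _} {_ , _ , l' , _} refl refl = <-asym l l'

  joins-unique : ∀ {e e' a b} → Joins e a b → Joins e' a b → e ≡ e'
  joins-unique (inj₁ (s , t)) (inj₁ (s' , t')) = edge-ext (trans s (sym s')) (trans t (sym t'))
  joins-unique (inj₂ (s , t)) (inj₂ (s' , t')) = edge-ext (trans s (sym s')) (trans t (sym t'))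
  joins-unique {e} {e'} (inj₁ (s , t)) (inj₂ (s' , t')) =
    ⊥-elim (no-crossing {e} {e'} (trans s (sym t')) (trans t (sym s')))
  joins-unique {e} {e'} (inj₂ (s , t)) (inj₁ (s' , t')) =
    ⊥-elim (no-crossing {e} {e'} (trans s (sym t')) (trans t (sym s')))

  edge-cong : ∀ {a a' b b'} {p : adj G a b ≡ true} {p' : adj G a' b' ≡ true} →
              a ≡ a' → b ≡ b' → edge G a b p ≡ edge G a' b' p'
  edge-cong {p = p} {p'} refl refl = joins-unique (edge-joins p) (edge-joins p')

  edge-sym : ∀ {a b} {p : adj G a b ≡ true} {p' : adj G b a ≡ true} → edge G a b p ≡ edge G b a p'
  edge-sym {a} {b} {p} {p'} = joins-unique (edge-joins p) (swap {edge G b a p'} (edge-joins p'))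
    where
    swap : ∀ {e} → Joins e b a → Joins e a b
    swap (inj₁ st) = inj₂ st
    swap (inj₂ st) = inj₁ st

  edge-self : (e : Edge G) → edge G (src e) (tgt e) (proj₂ (proj₂ (proj₂ e))) ≡ e
  edge-self e = joins-unique (edge-joins _) (inj₁ (refl , refl))

  OneOf : Vertex G → Vertex G → Vertex G → Vertex G → Set
  OneOf x a b c = (x ≡ a) ⊎ (x ≡ b) ⊎ (x ≡ c)

  triangle-side : ∀ {e a b c} → _∈△_ {G} e (a , b , c) →
                  Joins e a b ⊎ Joins e b c ⊎ Joins e c a
  triangle-side {e} (x , y) = sides x y
    where
    loop : ∀ {A : Set} → src e ≡ tgt e → A
    loop s≡t = ⊥-elim (<-irrefl s≡t (proj₁ (proj₂ (proj₂ e))))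
    sides : ∀ {a b c} → OneOf (src e) a b c → OneOf (tgt e) a b c →
            Joins e a b ⊎ Joins e b c ⊎ Joins e c a
    sides (inj₁ sa)        (inj₁ ta)        = loop (trans sa (sym ta))
    sides (inj₂ (inj₁ sb)) (inj₂ (inj₁ tb)) = loop (trans sb (sym tb))
    sides (inj₂ (inj₂ sc)) (inj₂ (inj₂ tc)) = loop (trans sc (sym tc))
    sides (inj₁ sa)        (inj₂ (inj₁ tb)) = inj₁ (inj₁ (sa , tb))
    sides (inj₂ (inj₁ sb)) (inj₁ ta)        = inj₁ (inj₂ (sb , ta))
    sides (inj₂ (inj₁ sb)) (inj₂ (inj₂ tc)) = inj₂ (inj₁ (inj₁ (sb , tc)))
    sides (inj₂ (inj₂ sc)) (inj₂ (inj₁ tb)) = inj₂ (inj₁ (inj₂ (sc , tb)))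
    sides (inj₂ (inj₂ sc)) (inj₁ ta)        = inj₂ (inj₂ (inj₁ (sc , ta)))
    sides (inj₁ sa)        (inj₂ (inj₂ tc)) = inj₂ (inj₂ (inj₂ (sa , tc)))

  triangle-cycle : ∀ {a b c} → adj G a b ≡ true → adj G b c ≡ true → adj G c a ≡ true → Cycle G
  triangle-cycle {a} {b} {c} ab bc ca =
    record { ℓ = 0 ; vs = corner ; vs-inj = corner-injective ; vs-adj = side }
    where
    corner : Fin 3 → Vertex G
    corner 0F = a
    corner 1F = b
    corner 2F = c
    a≢b : a ≢ b
    a≢b = adjacent-distinct ab
    b≢c : b ≢ c
    b≢c = adjacent-distinct bc
    c≢a : c ≢ a
    c≢a = adjacent-distinct ca
    corner-injective : Injective _≡_ _≡_ corner
    corner-injective {0F} {0F} _ = refl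
    corner-injective {1F} {1F} _ = refl
    corner-injective {2F} {2F} _ = refl
    corner-injective {0F} {1F} e = ⊥-elim (a≢b e)
    corner-injective {1F} {0F} e = ⊥-elim (a≢b (sym e))
    corner-injective {1F} {2F} e = ⊥-elim (b≢c e)
    corner-injective {2F} {1F} e = ⊥-elim (b≢c (sym e))
    corner-injective {2F} {0F} e = ⊥-elim (c≢a e)
    corner-injective {0F} {2F} e = ⊥-elim (c≢a (sym e))
    side : ∀ i → adj G (corner i) (corner (next i)) ≡ true
    side 0F = ab
    side 1F = bc
    side 2F = ca

  NoLoneColour : (Edge G → Color) → Set
  NoLoneColour δ = ∀ c (C : Cycle G) → ¬ ExactlyOne δ c C

  module _ (δ : Edge G → Color) (no-lone : NoLoneColour δ) where

    triangle-monochromatic : ∀ {a b c} (ab : adj G a b ≡ true) (bc : adj G b c ≡ true) (ca : adj G c a ≡ true) →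
      δ (edge G a b ab) ≡ δ (edge G b c bc) × δ (edge G b c bc) ≡ δ (edge G c a ca)
    triangle-monochromatic ab bc ca =
      three-sides-agree (λ i → δ (cycEdge C i)) (λ c → no-lone c C)
      where
      C : Cycle G
      C = triangle-cycle ab bc ca

    triangle-colour : ∀ {e a b c} (ab : adj G a b ≡ true) (bc : adj G b c ≡ true) (ca : adj G c a ≡ true) →
      _∈△_ {G} e (a , b , c) → δ e ≡ δ (edge G a b ab)
    triangle-colour {e} {a} {b} {c} ab bc ca e∈abc = by-side (triangle-side {e} e∈abc)
      where
      ab≡bc : δ (edge G a b ab) ≡ δ (edge G b c bc)
      ab≡bc = proj₁ (triangle-monochromatic ab bc ca)
      bc≡ca : δ (edge G b c bc) ≡ δ (edge G c a ca)
      bc≡ca = proj₂ (triangle-monochromatic ab bc ca)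
      by-side : Joins e a b ⊎ Joins e b c ⊎ Joins e c a → δ e ≡ δ (edge G a b ab)
      by-side (inj₁ j)        = cong δ (joins-unique j (edge-joins ab))
      by-side (inj₂ (inj₁ j)) = trans (cong δ (joins-unique j (edge-joins bc))) (sym ab≡bc)
      by-side (inj₂ (inj₂ j)) = trans (cong δ (joins-unique j (edge-joins ca))) (sym (trans ab≡bc bc≡ca))

    monochromatic : (S : EdgeSet G) → TriangleConnected {G} S →
                    ∀ {e e'} → S e → S e' → δ e ≡ δ e'
    monochromatic S △-conn s s' =
      fold (λ e e' → δ e ≡ δ e') (λ r eq → trans (same-triangle r) eq) refl (△-conn _ _ s s')
      where
      same-triangle : ∀ {e e'} → TriRel {G} S e e' → δ e ≡ δ e'
      same-triangle (_ , (ab , _) , (bc , _) , (ca , _) , m , m') =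
        trans (triangle-colour ab bc ca m) (sym (triangle-colour ab bc ca m'))

  module _ (S : EdgeSet G) where

    Adjᴴ : Vertex G → Vertex G → Set
    Adjᴴ = HAdj {G} S

    Connected : Vertex G → Vertex G → Set
    Connected = Star Adjᴴ

    adjᴴ-sym : ∀ {a b} → Adjᴴ a b → Adjᴴ b a
    adjᴴ-sym {a} {b} (p , s) = trans (adj-sym G b a) p , subst S (edge-sym {a} {b}) s

    meet : ∀ {x y z} → Connected x z → Connected y z → Connected x y
    meet xz yz = xz ◅◅ reverse adjᴴ-sym yz

    edge-connected : ∀ {e x y} → S e → _∈ₑ_ {G} x e → _∈ₑ_ {G} y e → Connected x y
    edge-connected {e} s x∈e y∈e = meet (to-src x∈e) (to-src y∈e)
      where
      src-tgt : Adjᴴ (src e) (tgt e)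
      src-tgt = _ , subst S (sym (edge-self e)) s
      to-src : ∀ {x} → _∈ₑ_ {G} x e → Connected x (src e)
      to-src (inj₁ refl) = ε
      to-src (inj₂ refl) = adjᴴ-sym src-tgt ◅ ε

    triangle-connected : ∀ {a b c x y} → Adjᴴ a b → Adjᴴ b c → Adjᴴ c a →
                         OneOf x a b c → OneOf y a b c → Connected x y
    triangle-connected {a} ab bc ca x∈abc y∈abc = meet (to-a x∈abc) (to-a y∈abc)
      where
      to-a : ∀ {x} → OneOf x _ _ _ → Connected x a
      to-a (inj₁ refl)        = ε
      to-a (inj₂ (inj₁ refl)) = adjᴴ-sym ab ◅ ε
      to-a (inj₂ (inj₂ refl)) = ca ◅ ε

    linked-connected : ∀ {e e' x y} → Star (TriRel {G} S) e e' → S e' →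
                       _∈ₑ_ {G} x e → _∈ₑ_ {G} y e' → Connected x y
    linked-connected ε s' x∈e y∈e' = edge-connected s' x∈e y∈e'
    linked-connected {e} (_◅_ {j = m} (_ , ab , bc , ca , e∈t , m∈t) rest) s' x∈e y∈e' =
      triangle-connected ab bc ca (corner {e = e} x∈e e∈t) (proj₁ m∈t)
        ◅◅ linked-connected {x = src m} rest s' (inj₁ refl) y∈e'
      where
      corner : ∀ {x e a b c} → _∈ₑ_ {G} x e → _∈△_ {G} e (a , b , c) → OneOf x a b c
      corner (inj₁ refl) (s∈t , _) = s∈t
      corner (inj₂ refl) (_ , t∈t) = t∈t

    spanning-connected : Spanning {G} S → TriangleConnected {G} S → ∀ x y → Connected x y
    spanning-connected spanning △-conn x y with spanning x | spanning y
    ... | e , s , x∈e | e' , s' , y∈e' = linked-connected (△-conn e e' s s') s' x∈e y∈e'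

    -- A simple H-path from u to v with at least two edges closes up with an
    -- edge uv of G to a cycle whose last side is uv and whose other sides lie in H.
    module ClosedPath {u v : Vertex G} (uv : adj G u v ≡ true) {ℓ xs}
                      (path : SimplePaths.Path Fin._≟_ Adjᴴ u v (2 + ℓ) xs) where
      open SimplePaths Fin._≟_ Adjᴴ u

      after-last : lookup xs (next (fromℕ (2 + ℓ))) ≡ v
      after-last = trans (cong (lookup xs) (next-fromℕ (2 + ℓ))) (path-head path)

      after-inject₁ : ∀ j → lookup xs (next (inject₁ j)) ≡ lookup xs (suc j)
      after-inject₁ j = cong (lookup xs) (next-inject₁ j)

      closing-adj : ∀ i → adj G (lookup xs i) (lookup xs (next i)) ≡ true
      closing-adj i with view i
      ... | ‵fromℕ = subst₂ (λ x y → adj G x y ≡ true) (sym (path-last path)) (sym after-last) uv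
      ... | ‵inject₁ j = subst (λ y → adj G (lookup xs (inject₁ j)) y ≡ true) (sym (after-inject₁ j))
                               (proj₁ (adjᴴ-sym (path-link path j)))

      closing-cycle : Cycle G
      closing-cycle = record { ℓ = ℓ ; vs = lookup xs ; vs-inj = path-injective path ; vs-adj = closing-adj }

      closing-side : cycEdge closing-cycle (fromℕ (2 + ℓ)) ≡ edge G u v uv
      closing-side = edge-cong (path-last path) after-last

      path-side : ∀ j → S (cycEdge closing-cycle (inject₁ j))
      path-side j =
        subst S (edge-cong {a = lookup xs (inject₁ j)} {b = lookup xs (suc j)} refl (sym (after-inject₁ j)))
                (proj₂ (adjᴴ-sym (path-link path j)))

    module _ (δ : Edge G → Color) (no-lone : NoLoneColour δ) where

      -- If no edge of H has the colour of f, no simple H-path joins the endpoints of f: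
      -- it would have to be f itself, or close up with f to a cycle with one edge of
      -- that colour.
      no-path-across : (f : Edge G) → (∀ e → S e → δ e ≢ δ f) →
                       ¬ SimplePaths.SimplePath Fin._≟_ Adjᴴ (src f) (tgt f)
      no-path-across f@(u , v , u<v , uv) avoid (k , _ , path) = across k path
        where
        open SimplePaths Fin._≟_ Adjᴴ u
        across : ∀ k {xs} → Path v k xs → ⊥
        across 0 p = <-irrefl (trans (sym (path-last p)) (path-head p)) u<v
        across 1 p = avoid _ (proj₂ (path-link p zero))
                       (cong δ (trans (edge-cong (path-last p) (path-head p)) (edge-self f)))
        across (ℕ.suc (ℕ.suc ℓ)) p =
          no-lone (δ f) closing-cycle (fromℕ _ , cong δ (trans closing-side (edge-self f)) , only-f)
          where
          open ClosedPath uv p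
          only-f : ∀ j → δ (cycEdge closing-cycle j) ≡ δ f → j ≡ fromℕ _
          only-f j same with last-or-inject₁ j
          ... | inj₁ j≡last      = j≡last
          ... | inj₂ (i , refl) = ⊥-elim (avoid (cycEdge closing-cycle (inject₁ i)) (path-side i) same)

theorem2 : (G : Graph) (δ : Edge G → Color) → IsNACColoring G δ →
    ¬ Σ (EdgeSet G) (λ S → Spanning {G} S × TriangleConnected {G} S)
theorem2 G δ (blue-edge , red-edge , no-lone-blue , no-lone-red) (S , spanning , △-conn) =
  no-path-across G S δ no-lone f avoid
    (SimplePaths.simple-path Fin._≟_ (Adjᴴ G S) (src G f)
      (spanning-connected G S spanning △-conn (src G f) (tgt G f)))
  where
  no-lone : NoLoneColour G δ
  no-lone blue = no-lone-blue
  no-lone red  = no-lone-red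

  -- H has an edge, since G has a vertex and H spans G
  e₀ : Edge G
  e₀ = proj₁ (spanning (src G (proj₁ blue-edge)))

  e₀∈H : S e₀
  e₀∈H = proj₁ (proj₂ (spanning (src G (proj₁ blue-edge))))

  f : Edge G
  f = proj₁ (avoiding-edge δ blue-edge red-edge (δ e₀))

  avoid : ∀ e → S e → δ e ≢ δ f
  avoid e e∈H same =
    proj₂ (avoiding-edge δ blue-edge red-edge (δ e₀))
      (trans (sym same) (monochromatic G δ no-lone S △-conn e∈H e₀∈H))
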